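{- Let $\lambda\neq0$ and $\mu$ be constants and define numbers $b_j(N)=b_j(N;\lambda,\mu)$ for integers $N\ge0$, $j\ge0$ by $b_0(0)=1$, $b_j(0)=0$ for $j\ge1$, and for $N\ge0$: $$b_0(N+1)=(N\lambda+1)\,b_0(N),\qquad b_j(N+1)=(N\lambda+j+1)\,b_j(N)+j\mu\, b_{j-1}(N)\quad(j\ge1).$$ (In particular $b_j(N)=0$ for $j\ge N+1$.) Then for every $N\ge1$ and every $j=1,2,\ldots,N$, $$b_j(N)=j\mu\sum_{i=0}^{N-j}\big((N-1)\lambda+j+1\,\big|\,\lambda\big)_i\,b_{j-1}(N-i-1).$$
   Context: $(x\mid\lambda)_n=x(x-\lambda)(x-2\lambda)\cdots(x-(n-1)\lambda)$, with $(x\mid\lambda)_0=1$. The numbers $b_j(N)$ are exactly the coefficients for which $F(t)=\frac{1}{(1+\lambda t)^{1/\lambda}-\mu}$ satisfies $F^{(N)}=\frac{(-1)^N}{(1+\lambda t)^N}\sum_{i=1}^{N+1}b_{i-1}(N)F^i$. -}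

module Defs where

open import Data.Nat using (ℕ; zero; suc)
open import Algebra.Bundles using (CommutativeRing)

module RingDefs {c ℓ} (R : CommutativeRing c ℓ) where
  open CommutativeRing R hiding (zero)

  fromℕ : ℕ → Carrier
  fromℕ zero    = 0#
  fromℕ (suc n) = 1# + fromℕ n

  fall : Carrier → Carrier → ℕ → Carrier
  fall x lam zero    = 1#
  fall x lam (suc n) = fall x lam n * (x - fromℕ n * lam)

  sumTo : ℕ → (ℕ → Carrier) → Carrier
  sumTo zero    f = f zero
  sumTo (suc n) f = sumTo n f + f (suc n)

  b : Carrier → Carrier → ℕ → ℕ → Carrier
  b lam mu zero    zero    = 1#
  b lam mu (suc j) zero    = 0#
  b lam mu zero    (suc N) = (fromℕ N * lam + 1#) * b lam mu zero N
  b lam mu (suc j) (suc N) =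
    (fromℕ N * lam + fromℕ (suc j) + 1#) * b lam mu (suc j) N
    + fromℕ (suc j) * mu * b lam mu j N

-- Unrolling the recurrence b_j(K+1) = X_K b_j(K) + jμ b_{j-1}(K), where X_K = Kλ + j + 1,
-- expresses b_j(K+1) as jμ Σ_i X_K X_{K-1} ⋯ X_{K-i+1} b_{j-1}(K-i), and the product of
-- consecutive X's is the falling factorial (X_K | λ)_i because X_{K-1} = X_K - λ. The
-- unrolling may stop at b_j(j-1), which vanishes, so the sum runs over i ≤ N - j.
module Submission where

open import Defs
open import Data.Nat using (ℕ; zero; suc; _<_; _≤_; _∸_; s≤s)
import Data.Nat as ℕ
open import Data.Nat.Properties using (m≤n⇒m≤1+n; n<1+n; +-suc; m+[n∸m]≡n)
import Data.Nat.Properties as ℕₚ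
open import Algebra.Bundles using (CommutativeRing)
open import Relation.Nullary using (¬_)
import Relation.Binary.PropositionalEquality as ≡

module _ {c ℓ} (R : CommutativeRing c ℓ) where
  open CommutativeRing R hiding (zero)
  open RingDefs R
  open import Relation.Binary.Reasoning.Setoid setoid
  open import Algebra.Properties.Ring ring using (-0#≈0#)
  open import Algebra.Properties.AbelianGroup +-abelianGroup using (⁻¹-∙-comm)
  open import Algebra.Solver.Ring.NaturalCoefficients.Default commutativeSemiring

  sumTo-cong : ∀ n {f g : ℕ → Carrier} → (∀ i → f i ≈ g i) → sumTo n f ≈ sumTo n g
  sumTo-cong zero    f≈g = f≈g zero
  sumTo-cong (suc n) f≈g = +-cong (sumTo-cong n f≈g) (f≈g (suc n))

  sumTo-suc : ∀ n (f : ℕ → Carrier) → sumTo (suc n) f ≈ f zero + sumTo n (λ i → f (suc i))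
  sumTo-suc zero    f = refl
  sumTo-suc (suc n) f = trans (+-congʳ (sumTo-suc n f)) (+-assoc _ _ _)

  *-distribˡ-sumTo : ∀ n a (f : ℕ → Carrier) → a * sumTo n f ≈ sumTo n (λ i → a * f i)
  *-distribˡ-sumTo zero    a f = refl
  *-distribˡ-sumTo (suc n) a f = trans (distribˡ a _ _) (+-congʳ (*-distribˡ-sumTo n a f))

  +-[1+n]*-cancel : ∀ y a n → (y + a) - (1# + n) * a ≈ y - n * a
  +-[1+n]*-cancel y a n = begin
    (y + a) - (1# + n) * a        ≈⟨ +-congˡ (-‿cong (trans (distribʳ a 1# n) (+-congʳ (*-identityˡ a)))) ⟩
    (y + a) - (a + n * a)         ≈⟨ +-congˡ (sym (⁻¹-∙-comm a (n * a))) ⟩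
    (y + a) + (- a + - (n * a))   ≈⟨ solve 4 (λ y a a⁻ b → (y :+ a) :+ (a⁻ :+ b) := (y :+ (a :+ a⁻)) :+ b) refl y a (- a) (- (n * a)) ⟩
    (y + (a - a)) - n * a         ≈⟨ +-congʳ (trans (+-congˡ (-‿inverseʳ a)) (+-identityʳ y)) ⟩
    y - n * a                     ∎

  fall-suc : ∀ {x y} lam → y + lam ≈ x → ∀ i → fall x lam (suc i) ≈ x * fall y lam i
  fall-suc {x} lam _ zero = begin
    1# * (x - 0# * lam)  ≈⟨ *-identityˡ _ ⟩
    x - 0# * lam         ≈⟨ +-congˡ (trans (-‿cong (zeroˡ lam)) -0#≈0#) ⟩
    x + 0#               ≈⟨ +-identityʳ x ⟩
    x                    ≈⟨ sym (*-identityʳ x) ⟩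
    x * 1#               ∎
  fall-suc {x} {y} lam y+lam≈x (suc i) = begin
    fall x lam (suc i) * (x - fromℕ (suc i) * lam)
      ≈⟨ *-cong (fall-suc lam y+lam≈x i) (+-congʳ (sym y+lam≈x)) ⟩
    x * fall y lam i * ((y + lam) - (1# + fromℕ i) * lam)
      ≈⟨ *-congˡ (+-[1+n]*-cancel y lam (fromℕ i)) ⟩
    x * fall y lam i * (y - fromℕ i * lam)
      ≈⟨ *-assoc _ _ _ ⟩
    x * fall y lam (suc i) ∎

  module _ (lam mu : Carrier) where

    b-vanishes : ∀ {j N} → N < j → b lam mu j N ≈ 0#
    b-vanishes {suc j} {zero}  _         = refl
    b-vanishes {suc j} {suc N} (s≤s N<j) = begin
      _ * b lam mu (suc j) N + _ * b lam mu j N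
        ≈⟨ +-cong (*-congˡ (b-vanishes (m≤n⇒m≤1+n N<j))) (*-congˡ (b-vanishes N<j)) ⟩
      _ * 0# + _ * 0#  ≈⟨ +-cong (zeroʳ _) (zeroʳ _) ⟩
      0# + 0#          ≈⟨ +-identityʳ 0# ⟩
      0#               ∎

    module _ (j : ℕ) where

      stepFactor : ℕ → Carrier
      stepFactor K = fromℕ K * lam + fromℕ (suc j) + 1#

      jμ : Carrier
      jμ = fromℕ (suc j) * mu

      unrolled : ℕ → ℕ → Carrier
      unrolled K m = jμ *
        sumTo m (λ i → fall (stepFactor K) lam i * b lam mu j (suc K ∸ i ∸ 1))

      b-unroll : ∀ m → b lam mu (suc j) (suc (j ℕ.+ m)) ≈ unrolled (j ℕ.+ m) m
      b-unroll zero rewrite ℕₚ.+-identityʳ j = begin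
        stepFactor j * b lam mu (suc j) j + jμ * b lam mu j j
          ≈⟨ +-congʳ (*-congˡ (b-vanishes (n<1+n j))) ⟩
        stepFactor j * 0# + jμ * b lam mu j j
          ≈⟨ solve 3 (λ X a B → X :* con 0 :+ a :* B := a :* (con 1 :* B)) refl (stepFactor j) jμ (b lam mu j j) ⟩
        jμ * (1# * b lam mu j j) ∎
      b-unroll (suc m) rewrite +-suc j m = begin
        X′ * b lam mu (suc j) (suc K) + jμ * B
          ≈⟨ +-congʳ (*-congˡ (b-unroll m)) ⟩
        X′ * (jμ * S) + jμ * B
          ≈⟨ solve 4 (λ X a S B → X :* (a :* S) :+ a :* B := a :* (con 1 :* B :+ X :* S)) refl X′ jμ S B ⟩
        jμ * (1# * B + X′ * S)
          ≈⟨ *-congˡ (+-congˡ (*-distribˡ-sumTo m X′ _)) ⟩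
        jμ * (1# * B + sumTo m (λ i → X′ * (fall (stepFactor K) lam i * b lam mu j (suc K ∸ i ∸ 1))))
          ≈⟨ *-congˡ (+-congˡ (sumTo-cong m λ i → trans (sym (*-assoc _ _ _)) (*-congʳ (sym (fall-suc lam stepFactor-suc i))))) ⟩
        jμ * (1# * B + sumTo m (λ i → fall X′ lam (suc i) * b lam mu j (suc K ∸ i ∸ 1)))
          ≈⟨ *-congˡ (sym (sumTo-suc m _)) ⟩
        unrolled (suc K) (suc m) ∎
        where
        K : ℕ
        K = j ℕ.+ m
        X′ B S : Carrier
        X′ = stepFactor (suc K)
        B = b lam mu j (suc K)
        S = sumTo m (λ i → fall (stepFactor K) lam i * b lam mu j (suc K ∸ i ∸ 1))
        stepFactor-suc : stepFactor K + lam ≈ X′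
        stepFactor-suc = solve 4 (λ n l a o → (n :* l :+ a :+ o) :+ l := (con 1 :+ n) :* l :+ a :+ o)
                           refl (fromℕ K) lam (fromℕ (suc j)) 1#

lemma5 : ∀ {c ℓ} (R : CommutativeRing c ℓ) →
    let open CommutativeRing R
        open RingDefs R
    in (lam mu : Carrier) → ¬ (lam ≈ 0#) →
       ∀ (N j : ℕ) → 1 ≤ j → j ≤ N →
       b lam mu j N ≈
         (fromℕ j * mu) *
           sumTo (N ∸ j) (λ i →
             fall (fromℕ (N ∸ 1) * lam + fromℕ j + 1#) lam i
               * b lam mu (j ∸ 1) (N ∸ i ∸ 1))
lemma5 R lam mu _ (suc N) (suc j) _ (s≤s j≤N) =
  ≡.subst (λ K → b lam mu (suc j) (suc K) ≈ unrolled R lam mu j K (N ∸ j))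
          (m+[n∸m]≡n j≤N) (b-unroll R lam mu j (N ∸ j))
  where
  open CommutativeRing R using (_≈_)
  open RingDefs R using (b)
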